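{- Let $L$ be a complete bounded distributive lattice. For a set $X$, let $f$ be the unary operation on $L^X$ given by $f(\alpha)(x)=\bigvee\{\alpha(y):y\in X\}$ (the convolution of the relation $X\times X$). The following are equivalent: (1) for every set $X$, the identity $f(a)\wedge f(b)=f(f(a)\wedge b)$ holds for all $a,b\in L^X$ (with $\wedge$ pointwise); (2) $L$ satisfies $u\wedge\bigvee_{j\in J}v_j=\bigvee_{j\in J}(u\wedge v_j)$ for all $u\in L$ and all families $(v_j)_{j\in J}$ in $L$ (so $L$ is the lattice reduct of a complete Heyting algebra). -}

module Defs where

open import Level using (Level; _⊔_; suc)
open import Algebra.Lattice.Bundles using (DistributiveLattice)

-- Arbitrary joins and meets are
-- taken over families indexed by types ("sets") in universe level ι.
record CompleteBoundedDistributiveLattice (c ℓ ι : Level) : Set (suc (c ⊔ ℓ ⊔ ι)) where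
  field
    distributiveLattice : DistributiveLattice c ℓ
  open DistributiveLattice distributiveLattice public

  infix 4 _≤_
  _≤_ : Carrier → Carrier → Set ℓ
  x ≤ y = (x ∧ y) ≈ x

  field
    ⊤ : Carrier
    ⊥ : Carrier
    ⊤-max : ∀ x → x ≤ ⊤
    ⊥-min : ∀ x → ⊥ ≤ x
    ⋁ : {I : Set ι} → (I → Carrier) → Carrier
    ⋁-upper : {I : Set ι} (v : I → Carrier) (i : I) → v i ≤ ⋁ v
    ⋁-least : {I : Set ι} (v : I → Carrier) (z : Carrier) → (∀ i → v i ≤ z) → ⋁ v ≤ z
    ⋀ : {I : Set ι} → (I → Carrier) → Carrier
    ⋀-lower : {I : Set ι} (v : I → Carrier) (i : I) → ⋀ v ≤ v i
    ⋀-greatest : {I : Set ι} (v : I → Carrier) (z : Carrier) → (∀ i → z ≤ v i) → z ≤ ⋀ v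

module _ {c ℓ ι : Level} (L : CompleteBoundedDistributiveLattice c ℓ ι) where
  open CompleteBoundedDistributiveLattice L

  conv : {X : Set ι} → (X → Carrier) → (X → Carrier)
  conv {X} α x = ⋁ {X} α

  Condition1 : Set (suc ι ⊔ c ⊔ ℓ)
  Condition1 = (X : Set ι) (a b : X → Carrier) (x : X) →
    (conv a x ∧ conv b x) ≈ conv (λ y → conv a y ∧ b y) x

  Condition2 : Set (suc ι ⊔ c ⊔ ℓ)
  Condition2 = (u : Carrier) (J : Set ι) (v : J → Carrier) →
    (u ∧ ⋁ v) ≈ ⋁ (λ j → u ∧ v j)

module Submission where

-- Proof idea.  Condition (1) specialised to one point x is the statement
--   ⋁ a ∧ ⋁ b ≈ ⋁_y (⋁ a ∧ b y),
-- i.e. meet-distributivity of the single element u = ⋁ a over the family b.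
--
-- (2) ⇒ (1) is therefore immediate: take u = ⋁ a and v = b.
--
-- (1) ⇒ (2): given u and a family v indexed by J, apply (1) on the index set
-- X = Maybe J to the constant family a = u (whose join is u, because X is
-- inhabited by nothing) and to the family b extending v by ⊥ at nothing
-- (whose join is ⋁ v, since ⊥ adds nothing).  The extra summand u ∧ ⊥ on the
-- right-hand side lies below ⊥ and is absorbed as well.

open import Defs
open import Level using (Level)
open import Data.Product using (_×_; _,_)
open import Data.Maybe using (Maybe; nothing; just; maybe′)
open import Relation.Binary.Bundles using (Poset)
import Algebra.Lattice.Properties.Lattice as LatticeProperties
import Relation.Binary.Reasoning.Setoid as SetoidReasoning

module CompleteLatticeFacts {c ℓ ι : Level} (L : CompleteBoundedDistributiveLattice c ℓ ι) where
  open CompleteBoundedDistributiveLattice L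
  open LatticeProperties lattice using (∧-idem; poset)
  open SetoidReasoning setoid

  -- The standard library orders a lattice by x ≈ x ∧ y; the order of Defs
  -- is the symmetric reading x ∧ y ≈ x, so the partial-order laws transfer.
  private module P = Poset poset

  ≤-reflexive : ∀ {x y} → x ≈ y → x ≤ y
  ≤-reflexive x≈y = sym (P.reflexive x≈y)

  ≤-trans : ∀ {x y z} → x ≤ y → y ≤ z → x ≤ z
  ≤-trans x≤y y≤z = sym (P.trans (sym x≤y) (sym y≤z))

  ≤-antisym : ∀ {x y} → x ≤ y → y ≤ x → x ≈ y
  ≤-antisym x≤y y≤x = P.antisym (sym x≤y) (sym y≤x)

  x∧y≤y : ∀ x y → (x ∧ y) ≤ y
  x∧y≤y x y = begin
    (x ∧ y) ∧ y ≈⟨ ∧-assoc x y y ⟩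
    x ∧ (y ∧ y) ≈⟨ ∧-cong refl (∧-idem y) ⟩
    x ∧ y       ∎

  ⋁-mono : {I : Set ι} {v w : I → Carrier} → (∀ i → v i ≤ w i) → ⋁ v ≤ ⋁ w
  ⋁-mono {w = w} v≤w = ⋁-least _ (⋁ w) (λ i → ≤-trans (v≤w i) (⋁-upper w i))

  ⋁-cong : {I : Set ι} {v w : I → Carrier} → (∀ i → v i ≈ w i) → ⋁ v ≈ ⋁ w
  ⋁-cong v≈w = ≤-antisym (⋁-mono (λ i → ≤-reflexive (v≈w i)))
                         (⋁-mono (λ i → ≤-reflexive (sym (v≈w i))))

  ⋁-const : {I : Set ι} → I → (u : Carrier) → ⋁ {I} (λ _ → u) ≈ u
  ⋁-const i u = ≤-antisym (⋁-least _ u (λ _ → ≤-reflexive refl)) (⋁-upper _ i)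

  ⋁-adjoin : {J : Set ι} (v : J → Carrier) (w : Carrier) → w ≤ ⋁ v →
             ⋁ (maybe′ v w) ≈ ⋁ v
  ⋁-adjoin v w w≤⋁v = ≤-antisym (⋁-least _ (⋁ v) below) above
    where
    below : ∀ y → maybe′ v w y ≤ ⋁ v
    below nothing  = w≤⋁v
    below (just j) = ⋁-upper v j

    above : ⋁ v ≤ ⋁ (maybe′ v w)
    above = ⋁-least v _ (λ j → ⋁-upper (maybe′ v w) (just j))

  ⋁-adjoin-⊥ : {J : Set ι} (v : J → Carrier) → ⋁ (maybe′ v ⊥) ≈ ⋁ v
  ⋁-adjoin-⊥ v = ⋁-adjoin v ⊥ (⊥-min (⋁ v))

module Equivalence {c ℓ ι : Level} (L : CompleteBoundedDistributiveLattice c ℓ ι) where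
  open CompleteBoundedDistributiveLattice L
  open CompleteLatticeFacts L
  open SetoidReasoning setoid

  condition1⇒condition2 : Condition1 L → Condition2 L
  condition1⇒condition2 cond1 u J v = begin
    u ∧ ⋁ v                              ≈⟨ ∧-cong (sym (⋁-const nothing u)) (sym (⋁-adjoin-⊥ v)) ⟩
    ⋁ (λ _ → u) ∧ ⋁ (maybe′ v ⊥)         ≈⟨ cond1 (Maybe J) (λ _ → u) (maybe′ v ⊥) nothing ⟩
    ⋁ (λ y → ⋁ (λ _ → u) ∧ maybe′ v ⊥ y) ≈⟨ ⋁-cong meet-extended ⟩
    ⋁ (maybe′ (λ j → u ∧ v j) (u ∧ ⊥))   ≈⟨ ⋁-adjoin _ (u ∧ ⊥) u∧⊥-small ⟩
    ⋁ (λ j → u ∧ v j)                    ∎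
    where
    meet-extended : ∀ y → (⋁ {Maybe J} (λ _ → u) ∧ maybe′ v ⊥ y)
                          ≈ maybe′ (λ j → u ∧ v j) (u ∧ ⊥) y
    meet-extended nothing  = ∧-cong (⋁-const nothing u) refl
    meet-extended (just j) = ∧-cong (⋁-const nothing u) refl

    u∧⊥-small : (u ∧ ⊥) ≤ ⋁ (λ j → u ∧ v j)
    u∧⊥-small = ≤-trans (x∧y≤y u ⊥) (⊥-min _)

  condition2⇒condition1 : Condition2 L → Condition1 L
  condition2⇒condition1 cond2 X a b _ = cond2 (⋁ a) X b

proposition4p13 : {c ℓ ι : Level} (L : CompleteBoundedDistributiveLattice c ℓ ι) →
    (Condition1 L → Condition2 L) × (Condition2 L → Condition1 L)
proposition4p13 L = Equivalence.condition1⇒condition2 L , Equivalence.condition2⇒condition1 L
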